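{- Let $n\geq 2$. Then \[ \max_{S \in S_1,\ (R,C)=\operatorname{E}_1(S)} \frac{C}{R} = n+1 . \] In other words, for every valid input $S$ of $\operatorname{E}_1$ the number $C$ of cases checked satisfies $C \le (n+1)|S|$, and equality is attained for some valid input.
   Context: For a positive integer $\ell$, the pruning function $\operatorname{P}_{\ell}:\mathbb{Z}_{>0}\to\mathbb{Z}_{\geq 0}$ is defined as follows: write $m$ in binary, padded on the left with zeros as needed, and let $z$ be the position (position $0$ being the least significant bit) of the $\ell$-th zero bit counted from the right. Let $q = 2^{z}\lfloor m/2^{z}\rfloor$ (i.e. $m$ with all bits to the right of that zero set to $0$). Then $\operatorname{P}_{\ell}(m) = \max(q-1,0)$. (E.g. $\operatorname{P}_1(23)=15$, $\operatorname{P}_2(23)=0$.) The efficiency algorithm $\operatorname{E}_{\ell}$ (for given integers $n\ge 2$, $\ell>0$) takes as input a nonempty $S\subseteq\{1,\ldots,2^n-1\}$ and outputs a pair $(R,C)$: initialize $j\leftarrow 2^n-1$, $R\leftarrow 0$, $C\leftarrow 0$; while $j>0$: set $C\leftarrow C+1$; if $j\in S$ then $R\leftarrow R+1$ and $j\leftarrow j-1$; otherwise $j\leftarrow \operatorname{P}_{\ell}(j)$. Return $(R,C)$. An input $S$ is called valid if the output satisfies $R=|S|$; $S_{\ell}$ denotes the set of all valid inputs (for the given $n$ and $\ell$). Here $\ell=1$. -}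

module Defs where

open import Data.Nat using (ℕ; zero; suc; _+_; _*_; _∸_; _^_; _≤_; _<_; NonZero)
open import Data.Nat.DivMod using (_/_; _%_)
open import Data.Nat.Properties using (_≟_; m^n≢0)
open import Data.Bool using (Bool; true; false; if_then_else_)
open import Data.Product using (_×_; _,_; proj₁; proj₂; ∃)
open import Relation.Binary.PropositionalEquality using (_≡_)
open import Relation.Nullary using (yes; no)

-- zeroPos f k m : position (0 = least significant bit) of the (k+1)-th zero
-- bit of m counted from the right (binary padded with zeros on the left).
-- f is fuel; f = m is always sufficient since m / 2 < m for m > 0.
zeroPos : ℕ → ℕ → ℕ → ℕ
zeroPos _       k       zero    = k
zeroPos zero    k       (suc m) = 0   -- unreachable when fuel ≥ m
zeroPos (suc f) k       (suc m) with suc m % 2 ≟ 0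
... | no  _ = suc (zeroPos f k (suc m / 2))
zeroPos (suc f) zero    (suc m) | yes _ = 0
zeroPos (suc f) (suc k) (suc m) | yes _ = suc (zeroPos f k (suc m / 2))

zpos : (ℓ : ℕ) → .{{NonZero ℓ}} → ℕ → ℕ
zpos (suc k) m = zeroPos m k m

prune : (ℓ : ℕ) → .{{NonZero ℓ}} → ℕ → ℕ
prune ℓ m = (2 ^ z) * (m / (2 ^ z)) ∸ 1
  where
    z = zpos ℓ m
    instance
      nz : NonZero (2 ^ z)
      nz = m^n≢0 2 z

-- subsets of ℕ are represented by their Boolean characteristic function

-- main loop of E_ℓ, with fuel (j strictly decreases each iteration and starts
-- at 2^n - 1, so fuel 2^n suffices).  State: j, R, C.  Returns (R , C).
loop : (ℓ : ℕ) → .{{NonZero ℓ}} → (ℕ → Bool) → ℕ → ℕ → ℕ → ℕ → ℕ × ℕ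
loop ℓ S zero     j       R C = R , C
loop ℓ S (suc f)  zero    R C = R , C
loop ℓ S (suc f)  (suc j) R C =
  if S (suc j)
  then loop ℓ S f j (suc R) (suc C)
  else loop ℓ S f (prune ℓ (suc j)) R (suc C)

E : (n ℓ : ℕ) → .{{NonZero ℓ}} → (ℕ → Bool) → ℕ × ℕ
E n ℓ S = loop ℓ S (2 ^ n) (2 ^ n ∸ 1) 0 0

InRange : ℕ → (ℕ → Bool) → Set
InRange n S = ∀ j → S j ≡ true → 1 ≤ j × j < 2 ^ n

Nonempty : (ℕ → Bool) → Set
Nonempty S = ∃ λ j → S j ≡ true

countBelow : (ℕ → Bool) → ℕ → ℕ
countBelow S zero    = 0
countBelow S (suc k) = (if S k then 1 else 0) + countBelow S k

card : ℕ → (ℕ → Bool) → ℕ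
card n S = countBelow S (2 ^ n)

Valid : (n ℓ : ℕ) → .{{NonZero ℓ}} → (ℕ → Bool) → Set
Valid n ℓ S = InRange n S × Nonempty S × proj₁ (E n ℓ S) ≡ card n S

-- For ℓ = 1, the pruning step clears the trailing ones of j and subtracts 1, so
-- it either reaches 0 or strictly increases the number of trailing ones.  A
-- number below 2^n has fewer than n trailing ones, hence between two hits
-- there are at most n prunings, and C ≤ (n + 1) R.  Equality holds for
-- S = {2^n - 1}: after the hit at 1…11 the algorithm visits 1…10, 1…101, …,
-- 01…1 and then 0, which takes exactly n prunings.
module Submission where

open import Defs
open import Data.Nat using (ℕ; suc; _+_; _*_; _≤_)
open import Data.Bool using (Bool)
open import Data.Product using (_×_; _,_; proj₁; proj₂; ∃)
open import Relation.Binary.PropositionalEquality using (_≡_)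

open import Data.Nat using (zero; pred; _∸_; _^_; _<_; z≤n; s≤s; _≟_; _<?_; NonZero)
open import Data.Nat.Properties
open import Data.Nat.DivMod
open import Data.Nat.Divisibility
  using (_∣_; 1∣_; ∣-trans; ∣⇒≤; m∣m*n; n∣m*n; *-monoʳ-∣; *-cancelˡ-∣; n∣m⇒m%n≡0)
open import Data.Nat.Tactic.RingSolver using (solve-∀)
open import Function using (_∘_)
open import Data.Bool using (true; false)
open import Data.Sum using (_⊎_; inj₁; inj₂)
open import Data.Empty using (⊥-elim)
open import Relation.Nullary using (yes; no; ¬_; does; contradiction)
open import Relation.Nullary.Decidable using (dec-true; dec-false)
open import Data.Bool.Properties using (T-≡)
open import Function.Bundles using (Equivalence)
open import Relation.Binary.PropositionalEquality
  using (refl; sym; trans; cong; subst; module ≡-Reasoning)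

open ≡-Reasoning

data LowestBit : ℕ → Set where
  even : ∀ h → LowestBit (h * 2)
  odd  : ∀ h → LowestBit (suc (h * 2))

lowestBit : ∀ m → LowestBit m
lowestBit zero = even 0
lowestBit (suc m) with lowestBit m
... | even h = odd h
... | odd h  = even (suc h)

[1+h*2]%2≡1 : ∀ h → suc (h * 2) % 2 ≡ 1
[1+h*2]%2≡1 h = [m+kn]%n≡m%n 1 h 2

[1+h*2]/2≡h : ∀ h → suc (h * 2) / 2 ≡ h
[1+h*2]/2≡h h = begin
  (1 + h * 2) / 2         ≡⟨ +-distrib-/ 1 (h * 2) 1%2+h*2%2<2 ⟩
  1 / 2 + h * 2 / 2       ≡⟨ cong (0 +_) (m*n/n≡m h 2) ⟩
  h                       ∎
  where
  1%2+h*2%2<2 : 1 % 2 + h * 2 % 2 < 2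
  1%2+h*2%2<2 = subst (λ r → 1 + r < 2) (sym (m*n%n≡0 h 2)) (s≤s (s≤s z≤n))

2∤1+h*2 : ∀ h → ¬ (2 ∣ suc (h * 2))
2∤1+h*2 h 2∣ = 1+n≢0 (trans (sym ([1+h*2]%2≡1 h)) (n∣m⇒m%n≡0 _ 2 2∣))

2^-cancelʳ-< : ∀ {k n} → 2 ^ k < 2 ^ n → k < n
2^-cancelʳ-< {k} {n} 2^k<2^n with k <? n
... | yes k<n = k<n
... | no  k≮n = contradiction (^-monoʳ-≤ 2 (≮⇒≥ k≮n)) (<⇒≱ 2^k<2^n)

ones : ℕ → ℕ
ones zero    = 0
ones (suc k) = suc (ones k * 2)

2^≡1+ones : ∀ k → 2 ^ k ≡ suc (ones k)
2^≡1+ones zero    = refl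
2^≡1+ones (suc k) = trans (cong (2 *_) (2^≡1+ones k)) (*-comm 2 (suc (ones k)))

ones<2^ : ∀ k → ones k < 2 ^ k
ones<2^ k = ≤-reflexive (sym (2^≡1+ones k))

n≤ones : ∀ k → k ≤ ones k
n≤ones zero    = z≤n
n≤ones (suc k) = s≤s (≤-trans (n≤ones k) (m≤m*n (ones k) 2))

appendZeroOnes : ℕ → ℕ → ℕ
appendZeroOnes a k = ones k + 2 ^ suc k * a

appendZeroOnes-zero : ∀ k → appendZeroOnes 0 k ≡ ones k
appendZeroOnes-zero k = trans (cong (ones k +_) (*-zeroʳ (2 ^ suc k))) (+-identityʳ (ones k))

a*2≡appendZeroOnes : ∀ a → a * 2 ≡ appendZeroOnes a 0
a*2≡appendZeroOnes a = *-comm a 2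

clearLow : ℕ → ℕ → ℕ
clearLow z m = 2 ^ z * (_/_ m (2 ^ z) {{m^n≢0 2 z}})

clearLow-zero : ∀ m → clearLow 0 m ≡ m
clearLow-zero m = trans (*-identityˡ (m / 1)) (n/1≡n m)

clearLow-suc : ∀ z m → clearLow (suc z) m ≡ 2 * clearLow z (m / 2)
clearLow-suc z m = begin
  2 * 2 ^ z * (m / (2 * 2 ^ z))  ≡⟨ cong (2 * 2 ^ z *_) (sym (m/n/o≡m/[n*o] m 2 (2 ^ z))) ⟩
  2 * 2 ^ z * (m / 2 / 2 ^ z)    ≡⟨ *-assoc 2 (2 ^ z) _ ⟩
  2 * clearLow z (m / 2)         ∎
  where instance _ = m^n≢0 2 z
                 _ = m^n≢0 2 (suc z)

clearLow-≤ : ∀ z m → clearLow z m ≤ m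
clearLow-≤ z m = ≤-trans (≤-reflexive (*-comm (2 ^ z) (m / 2 ^ z))) (m/n*n≤m m (2 ^ z))
  where instance _ = m^n≢0 2 z

zeroPos-even : ∀ f m → m % 2 ≡ 0 → zeroPos f 0 m ≡ 0
zeroPos-even _       zero    _ = refl
zeroPos-even zero    (suc m) _ = refl
zeroPos-even (suc f) (suc m) m%2≡0 with suc m % 2 ≟ 0
... | yes _   = refl
... | no  m%2≢0 = contradiction m%2≡0 m%2≢0

zeroPos-odd : ∀ f h → zeroPos (suc f) 0 (suc (h * 2)) ≡ suc (zeroPos f 0 h)
zeroPos-odd f h with suc (h * 2) % 2 ≟ 0
... | yes m%2≡0 = contradiction (trans (sym ([1+h*2]%2≡1 h)) m%2≡0) 1+n≢0
... | no  _     = cong (suc ∘ zeroPos f 0) ([1+h*2]/2≡h h)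

-- With fuel f ≥ m this is P₁'s q, i.e. prune 1 m ≡ clearTrailingOnes m m ∸ 1.
clearTrailingOnes : ℕ → ℕ → ℕ
clearTrailingOnes f m = clearLow (zeroPos f 0 m) m

clearTrailingOnes-even : ∀ f h → clearTrailingOnes f (h * 2) ≡ h * 2
clearTrailingOnes-even f h = begin
  clearLow (zeroPos f 0 (h * 2)) (h * 2)
    ≡⟨ cong (λ z → clearLow z (h * 2)) (zeroPos-even f (h * 2) (m*n%n≡0 h 2)) ⟩
  clearLow 0 (h * 2)
    ≡⟨ clearLow-zero (h * 2) ⟩
  h * 2 ∎

clearTrailingOnes-odd : ∀ f h →
  clearTrailingOnes (suc f) (suc (h * 2)) ≡ 2 * clearTrailingOnes f h
clearTrailingOnes-odd f h = begin
  clearLow (zeroPos (suc f) 0 m) m       ≡⟨ cong (λ z → clearLow z m) (zeroPos-odd f h) ⟩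
  clearLow (suc z) m                     ≡⟨ clearLow-suc z m ⟩
  2 * clearLow z (m / 2)                 ≡⟨ cong (λ x → 2 * clearLow z x) ([1+h*2]/2≡h h) ⟩
  2 * clearLow z h                       ∎
  where m = suc (h * 2)
        z = zeroPos f 0 h

clearTrailingOnes-≤ : ∀ f m → clearTrailingOnes f m ≤ m
clearTrailingOnes-≤ f m = clearLow-≤ (zeroPos f 0 m) m

-- 2 ^ k ∣ suc m says that m ends with at least k ones; clearing them leaves
-- at least k + 1 trailing zeros.
clearTrailingOnes-∣ : ∀ f m k → m ≤ f → 2 ^ k ∣ suc m →
                      2 ^ suc k ∣ clearTrailingOnes f m
clearTrailingOnes-∣ f m k m≤f 2^k∣ with lowestBit m
clearTrailingOnes-∣ f .(h * 2) zero _ _ | even h =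
  subst (2 ∣_) (sym (clearTrailingOnes-even f h)) (n∣m*n h)
clearTrailingOnes-∣ f .(h * 2) (suc k) _ 2^k∣ | even h =
  ⊥-elim (2∤1+h*2 h (∣-trans (m∣m*n (2 ^ k)) 2^k∣))
clearTrailingOnes-∣ (suc f) .(suc (h * 2)) zero _ _ | odd h =
  subst (2 ∣_) (sym (clearTrailingOnes-odd f h)) (m∣m*n (clearTrailingOnes f h))
clearTrailingOnes-∣ (suc f) .(suc (h * 2)) (suc k) (s≤s h*2≤f) 2^k∣ | odd h =
  subst (2 * 2 ^ suc k ∣_) (sym (clearTrailingOnes-odd f h)) (*-monoʳ-∣ 2 2^[1+k]∣)
  where
  2^k∣1+h : 2 ^ k ∣ suc h
  2^k∣1+h = *-cancelˡ-∣ 2 (subst (2 * 2 ^ k ∣_) (*-comm (suc h) 2) 2^k∣)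
  2^[1+k]∣ : 2 ^ suc k ∣ clearTrailingOnes f h
  2^[1+k]∣ = clearTrailingOnes-∣ f h k (≤-trans (m≤m*n h 2) h*2≤f) 2^k∣1+h

clearTrailingOnes-appendZeroOnes : ∀ f a k → k ≤ f →
  clearTrailingOnes f (appendZeroOnes a k) ≡ 2 ^ suc k * a
clearTrailingOnes-appendZeroOnes f a zero _ = begin
  clearTrailingOnes f (appendZeroOnes a 0)  ≡⟨ cong (clearTrailingOnes f) (sym (a*2≡appendZeroOnes a)) ⟩
  clearTrailingOnes f (a * 2)               ≡⟨ clearTrailingOnes-even f a ⟩
  a * 2                                     ≡⟨ *-comm a 2 ⟩
  2 ^ 1 * a                                 ∎
clearTrailingOnes-appendZeroOnes (suc f) a (suc k) (s≤s k≤f) = begin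
  clearTrailingOnes (suc f) (ones (suc k) + 2 * p * a)
    ≡⟨ cong (clearTrailingOnes (suc f)) (shift (ones k) p a) ⟩
  clearTrailingOnes (suc f) (suc ((ones k + p * a) * 2))
    ≡⟨ clearTrailingOnes-odd f (ones k + p * a) ⟩
  2 * clearTrailingOnes f (ones k + p * a)
    ≡⟨ cong (2 *_) (clearTrailingOnes-appendZeroOnes f a k k≤f) ⟩
  2 * (p * a)
    ≡⟨ sym (*-assoc 2 p a) ⟩
  2 * p * a ∎
  where
  p = 2 ^ suc k
  shift : ∀ o p a → suc (o * 2) + 2 * p * a ≡ suc ((o + p * a) * 2)
  shift = solve-∀

prune-≤ : ∀ m → prune 1 m ≤ m
prune-≤ m = ≤-trans (m∸n≤m _ 1) (clearTrailingOnes-≤ m m)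

prune-< : ∀ j → prune 1 (suc j) < suc j
prune-< j = s≤s (∸-monoˡ-≤ 1 (clearTrailingOnes-≤ (suc j) (suc j)))

prune-∣ : ∀ m k → 2 ^ k ∣ suc m → prune 1 m ≡ 0 ⊎ 2 ^ suc k ∣ suc (prune 1 m)
prune-∣ m k 2^k∣ with clearTrailingOnes m m | clearTrailingOnes-∣ m m k ≤-refl 2^k∣
... | zero  | _      = inj₁ refl
... | suc _ | 2^k+1∣ = inj₂ 2^k+1∣

prune-appendZeroOnes : ∀ a k → prune 1 (appendZeroOnes a k) ≡ 2 ^ suc k * a ∸ 1
prune-appendZeroOnes a k = cong (_∸ 1) (clearTrailingOnes-appendZeroOnes m a k k≤m)
  where m = appendZeroOnes a k
        k≤m = ≤-trans (n≤ones k) (m≤m+n (ones k) _)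

prune-ones : ∀ k → prune 1 (ones k) ≡ 0
prune-ones k = begin
  prune 1 (ones k)              ≡⟨ cong (prune 1) (sym (appendZeroOnes-zero k)) ⟩
  prune 1 (appendZeroOnes 0 k)  ≡⟨ prune-appendZeroOnes 0 k ⟩
  2 ^ suc k * 0 ∸ 1             ≡⟨ cong (_∸ 1) (*-zeroʳ (2 ^ suc k)) ⟩
  0                             ∎

prune-appendZeroOnes-ones : ∀ d k →
  prune 1 (appendZeroOnes (ones (suc d)) k) ≡ appendZeroOnes (ones d) (suc k)
prune-appendZeroOnes-ones d k = begin
  prune 1 (appendZeroOnes (ones (suc d)) k)
    ≡⟨ prune-appendZeroOnes (ones (suc d)) k ⟩
  2 ^ suc k * suc (ones d * 2) ∸ 1
    ≡⟨ cong (λ p → p * suc (ones d * 2) ∸ 1) (2^≡1+ones (suc k)) ⟩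
  suc o * suc (ones d * 2) ∸ 1
    ≡⟨ cong pred (expand o (ones d)) ⟩
  o + 2 * suc o * ones d
    ≡⟨ cong (λ p → o + 2 * p * ones d) (sym (2^≡1+ones (suc k))) ⟩
  appendZeroOnes (ones d) (suc k) ∎
  where
  o = ones (suc k)
  expand : ∀ o x → suc o * suc (x * 2) ≡ suc (o + 2 * suc o * x)
  expand = solve-∀

loop-zero : ∀ {ℓ} .{{_ : NonZero ℓ}} S f R C → loop ℓ S f 0 R C ≡ (R , C)
loop-zero S zero    R C = refl
loop-zero S (suc f) R C = refl

loop-hit : ∀ {ℓ} .{{_ : NonZero ℓ}} {S f j R C} → S (suc j) ≡ true →
           loop ℓ S (suc f) (suc j) R C ≡ loop ℓ S f j (suc R) (suc C)
loop-hit Sj rewrite Sj = refl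

loop-miss : ∀ {ℓ} .{{_ : NonZero ℓ}} {S f j R C} → 0 < j → S j ≡ false →
            loop ℓ S (suc f) j R C ≡ loop ℓ S f (prune ℓ j) R (suc C)
loop-miss {j = suc j} _ Sj rewrite Sj = refl

E≡loop : ∀ n ℓ .{{_ : NonZero ℓ}} S → E n ℓ S ≡ loop ℓ S (suc (ones n)) (ones n) 0 0
E≡loop n ℓ S rewrite 2^≡1+ones n = refl

WithinRatio : ℕ → ℕ × ℕ → Set
WithinRatio n RC = proj₂ RC ≤ (n + 1) * proj₁ RC

2^k∣1+j⇒k<n : ∀ {j k n} → 2 ^ k ∣ suc j → suc j < 2 ^ n → k < n
2^k∣1+j⇒k<n 2^k∣ j<2^n = 2^-cancelʳ-< (≤-<-trans (∣⇒≤ 2^k∣) j<2^n)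

module _ (n : ℕ) where

  budget-hit : ∀ {R C k} → k ≤ n → C + n ≤ (n + 1) * R + k → suc C + n ≤ (n + 1) * suc R + 0
  budget-hit {R} {C} {k} k≤n budget =
    ≤-trans (s≤s (≤-trans budget (+-monoʳ-≤ _ k≤n))) (≤-reflexive (reset n R))
    where
    reset : ∀ n R → suc ((n + 1) * R + n) ≡ (n + 1) * suc R + 0
    reset = solve-∀

  budget-miss : ∀ {R C k} → C + n ≤ (n + 1) * R + k → suc C + n ≤ (n + 1) * R + suc k
  budget-miss {k = k} budget = ≤-trans (s≤s budget) (≤-reflexive (sym (+-suc _ k)))

  budget⇒withinRatio : ∀ {R C k} → k ≤ n → C + n ≤ (n + 1) * R + k → WithinRatio n (R , C)
  budget⇒withinRatio {R} {C} {k} k≤n budget =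
    +-cancelʳ-≤ n C _ (≤-trans budget (+-monoʳ-≤ ((n + 1) * R) k≤n))

  -- j ends with k ones, so at most n - k prunings can precede the next hit;
  -- the budget C + n ≤ (n + 1) R + k reserves them.
  loop-withinRatio : ∀ S f j R C k → 2 ^ k ∣ suc j → suc j < 2 ^ n →
                     C + n ≤ (n + 1) * R + k → WithinRatio n (loop 1 S f j R C)
  loop-withinRatio S zero    j       R C k 2^k∣ j<2^n budget =
    budget⇒withinRatio (<⇒≤ (2^k∣1+j⇒k<n 2^k∣ j<2^n)) budget
  loop-withinRatio S (suc f) zero    R C k 2^k∣ j<2^n budget =
    budget⇒withinRatio (<⇒≤ (2^k∣1+j⇒k<n 2^k∣ j<2^n)) budget
  loop-withinRatio S (suc f) (suc j) R C k 2^k∣ j<2^n budget with S (suc j)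
  ... | true  = loop-withinRatio S f j (suc R) (suc C) 0 (1∣ _) (<⇒≤ j<2^n)
                  (budget-hit (<⇒≤ (2^k∣1+j⇒k<n 2^k∣ j<2^n)) budget)
  ... | false with prune-∣ (suc j) k 2^k∣
  ...   | inj₁ p≡0 = subst (WithinRatio n) (sym stops)
                       (budget⇒withinRatio (2^k∣1+j⇒k<n 2^k∣ j<2^n) (budget-miss budget))
    where
    stops : loop 1 S f (prune 1 (suc j)) R (suc C) ≡ (R , suc C)
    stops = trans (cong (λ p → loop 1 S f p R (suc C)) p≡0) (loop-zero S f R (suc C))
  ...   | inj₂ 2^k+1∣ = loop-withinRatio S f (prune 1 (suc j)) R (suc C) (suc k) 2^k+1∣
                          (≤-trans (s≤s (prune-< j)) (<⇒≤ j<2^n)) (budget-miss budget)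

E-withinRatio : ∀ n S → 0 < proj₁ (E n 1 S) → WithinRatio n (E n 1 S)
E-withinRatio n S R>0 =
  subst (WithinRatio n) (sym E≡) (fromAllOnes n (subst (λ RC → 0 < proj₁ RC) E≡ R>0))
  where
  E≡ = E≡loop n 1 S
  fromAllOnes : ∀ n → 0 < proj₁ (loop 1 S (suc (ones n)) (ones n) 0 0) →
                WithinRatio n (loop 1 S (suc (ones n)) (ones n) 0 0)
  fromAllOnes zero ()
  fromAllOnes (suc n) R>0 with S (suc (ones n * 2))
  ... | true  = loop-withinRatio (suc n) S (suc (ones n * 2)) (ones n * 2) 1 1 0
                  (1∣ _) (ones<2^ (suc n)) (≤-reflexive (start (suc n)))
    where
    start : ∀ n → 1 + n ≡ (n + 1) * 1 + 0
    start = solve-∀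
  -- missing 2^n - 1 prunes straight to 0, leaving R = 0
  ... | false = contradiction (subst (λ RC → 0 < proj₁ RC) stops R>0) λ ()
    where
    stops : loop 1 S (suc (ones n * 2)) (prune 1 (ones (suc n))) 0 1 ≡ (0 , 1)
    stops = trans (cong (λ p → loop 1 S (suc (ones n * 2)) p 0 1) (prune-ones (suc n)))
                  (loop-zero {1} S (suc (ones n * 2)) 0 1)

countBelow-pos : ∀ S {i} K → S i ≡ true → i < K → 0 < countBelow S K
countBelow-pos S {i} (suc K) Si i<1+K with S K in SK
... | true  = s≤s z≤n
... | false with m≤n⇒m<n∨m≡n (≤-pred i<1+K)
...   | inj₁ i<K  = countBelow-pos S K Si i<K
...   | inj₂ refl = contradiction (trans (sym Si) SK) λ ()

countBelow-none : ∀ S K → (∀ i → i < K → S i ≡ false) → countBelow S K ≡ 0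
countBelow-none S zero    _    = refl
countBelow-none S (suc K) none rewrite none K ≤-refl =
  countBelow-none S K (λ i i<K → none i (m<n⇒m<1+n i<K))

Valid⇒0<R : ∀ n S → Valid n 1 S → 0 < proj₁ (E n 1 S)
Valid⇒0<R n S (inRange , (i , Si) , R≡card) =
  subst (0 <_) (sym R≡card) (countBelow-pos S (2 ^ n) Si (proj₂ (inRange i Si)))

loop-pruneChain : ∀ S d k f R C → d < f → 0 < appendZeroOnes (ones d) k →
                  (∀ i → i ≤ appendZeroOnes (ones d) k → S i ≡ false) →
                  loop 1 S f (appendZeroOnes (ones d) k) R C ≡ (R , suc d + C)
loop-pruneChain S zero k (suc f) R C _ 0<j miss = begin
  loop 1 S (suc f) j R C            ≡⟨ loop-miss 0<j (miss j ≤-refl) ⟩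
  loop 1 S f (prune 1 j) R (suc C)  ≡⟨ cong (λ p → loop 1 S f p R (suc C)) prune≡0 ⟩
  loop 1 S f 0 R (suc C)            ≡⟨ loop-zero S f R (suc C) ⟩
  (R , suc C)                       ∎
  where
  j = appendZeroOnes (ones 0) k
  prune≡0 : prune 1 j ≡ 0
  prune≡0 = trans (cong (prune 1) (appendZeroOnes-zero k)) (prune-ones k)
loop-pruneChain S (suc d) k (suc f) R C (s≤s d<f) 0<j miss = begin
  loop 1 S (suc f) j R C            ≡⟨ loop-miss 0<j (miss j ≤-refl) ⟩
  loop 1 S f (prune 1 j) R (suc C)  ≡⟨ cong (λ p → loop 1 S f p R (suc C)) prune≡j′ ⟩
  loop 1 S f j′ R (suc C)           ≡⟨ loop-pruneChain S d (suc k) f R (suc C) d<f (s≤s z≤n) miss′ ⟩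
  (R , suc d + suc C)               ≡⟨ cong (R ,_) (+-suc (suc d) C) ⟩
  (R , suc (suc d) + C)             ∎
  where
  j  = appendZeroOnes (ones (suc d)) k
  j′ = appendZeroOnes (ones d) (suc k)
  prune≡j′ : prune 1 j ≡ j′
  prune≡j′ = prune-appendZeroOnes-ones d k
  miss′ : ∀ i → i ≤ j′ → S i ≡ false
  miss′ i i≤j′ = miss i (≤-trans i≤j′ (subst (_≤ j) prune≡j′ (prune-≤ j)))

singleton : ℕ → ℕ → Bool
singleton x j = does (j ≟ x)

singleton-self : ∀ x → singleton x x ≡ true
singleton-self x = dec-true (x ≟ x) refl

singleton-below : ∀ {x i} → i < x → singleton x i ≡ false
singleton-below {x} {i} i<x = dec-false (i ≟ x) (<⇒≢ i<x)

singleton-true⇒≡ : ∀ x i → singleton x i ≡ true → i ≡ x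
singleton-true⇒≡ x i Si = ≡ᵇ⇒≡ i x (Equivalence.from T-≡ Si)

E-singletonTop : ∀ m → E (2 + m) 1 (singleton (ones (2 + m))) ≡ (1 , 2 + m + 1)
E-singletonTop m = begin
  E (2 + m) 1 S             ≡⟨ E≡loop (2 + m) 1 S ⟩
  loop 1 S (suc x) x 0 0    ≡⟨ loop-hit {S = S} {f = x} {j = ones (suc m) * 2} (singleton-self x) ⟩
  loop 1 S x (pred x) 1 1   ≡⟨ cong (λ j → loop 1 S x j 1 1) pred-x≡j ⟩
  loop 1 S x j 1 1          ≡⟨ loop-pruneChain S (suc m) 0 x 1 1 m<x (s≤s z≤n) miss ⟩
  (1 , 2 + m + 1)           ∎
  where
  x = ones (2 + m)
  S = singleton x
  j = appendZeroOnes (ones (suc m)) 0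
  pred-x≡j : pred x ≡ j
  pred-x≡j = a*2≡appendZeroOnes (ones (suc m))
  m<x : suc m < x
  m<x = s≤s (≤-trans (n≤ones (suc m)) (m≤m*n (ones (suc m)) 2))
  miss : ∀ i → i ≤ j → S i ≡ false
  miss i i≤j = singleton-below (s≤s (≤-trans i≤j (≤-reflexive (sym pred-x≡j))))

Valid-singletonTop : ∀ m → Valid (2 + m) 1 (singleton (ones (2 + m)))
Valid-singletonTop m =
  inRange , (x , singleton-self x) , trans (cong proj₁ (E-singletonTop m)) (sym card≡1)
  where
  n = 2 + m
  x = ones n
  inRange : InRange n (singleton x)
  inRange i Si rewrite singleton-true⇒≡ x i Si = s≤s z≤n , ones<2^ n
  card≡1 : card n (singleton x) ≡ 1
  card≡1 rewrite 2^≡1+ones n | singleton-self x =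
    cong suc (countBelow-none (singleton x) x (λ i → singleton-below {x}))

mainTheorem2 : (n : ℕ) → 2 ≤ n →
    ((S : ℕ → Bool) → Valid n 1 S →
      proj₂ (E n 1 S) ≤ (n + 1) * proj₁ (E n 1 S))
    × (∃ λ (S : ℕ → Bool) → Valid n 1 S
      × proj₂ (E n 1 S) ≡ (n + 1) * proj₁ (E n 1 S))
mainTheorem2 n@(suc (suc m)) (s≤s (s≤s _)) =
  (λ S valid → E-withinRatio n S (Valid⇒0<R n S valid)) ,
  (singleton (ones n) , Valid-singletonTop m , attained)
  where
  attained : proj₂ (E n 1 (singleton (ones n))) ≡ (n + 1) * proj₁ (E n 1 (singleton (ones n)))
  attained rewrite E-singletonTop m = sym (*-identityʳ (n + 1))
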